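{- For every integer $n\ge 1$, the hypercube $Q_3^n$ contains exactly $2^{2^n}$ distinct latin bitrades.
   Context: Let $Q_k=\{0,1,\dots,k-1\}$ and $Q_k^n$ the set of all words of length $n$ over $Q_k$. A one-dimensional face of direction $i$ through $(a_1,\dots,a_n)\in Q_k^n$ is the set $\{(a_1,\dots,a_{i-1},x,a_{i+1},\dots,a_n) : x\in Q_k\}$. A set $B\subseteq Q_k^n$ is a latin bitrade if $|B\cap F|\in\{0,2\}$ for every one-dimensional face $F$ (the empty set counts as a latin bitrade). -}

module Defs where

open import Data.Nat using (ℕ; suc)
open import Data.Fin using (Fin)
open import Data.Vec using (Vec; _[_]≔_)
open import Data.Bool using (Bool; true)
open import Data.List using (List; filter; length)
open import Data.List.Membership.Propositional using (_∈_)
open import Data.Product using (_×_; ∃-syntax)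
open import Relation.Binary.PropositionalEquality using (_≡_)
open import Relation.Nullary using (¬_)
open import Level using (0ℓ)

-- Q_k = {0,…,k-1} is Fin k; Q_k^n is Vec (Fin k) n.
Word : ℕ → ℕ → Set
Word k n = Vec (Fin k) n

SubsetQ : ℕ → ℕ → Set
SubsetQ k n = Word k n → Bool

_≐_ : ∀ {k n} → SubsetQ k n → SubsetQ k n → Set
B ≐ C = ∀ w → B w ≡ C w

-- Number of x ∈ Q_k with B containing the word a with i-th coordinate set to x,
-- i.e. |B ∩ F| for the one-dimensional face F of direction i through a.
faceCount : ∀ {k n} → SubsetQ k n → Fin n → Word k n → ℕ
faceCount {k} B i a = length (filter (λ x → Data.Bool._≟_ (B (a [ i ]≔ x)) true) (Data.List.allFin k))
  where import Data.Bool
        import Data.List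

IsLatinBitrade : ∀ {k n} → SubsetQ k n → Set
IsLatinBitrade {k} {n} B = ∀ (i : Fin n) (a : Word k n) →
  (faceCount B i a ≡ 0) Data.Sum.⊎ (faceCount B i a ≡ 2)
  where import Data.Sum

-- "X contains exactly m distinct latin bitrades": there is a list of length m
-- of latin bitrades, pairwise distinct as sets, such that every latin bitrade
-- equals (as a set) one of the listed ones.
HasExactlyBitrades : ℕ → ℕ → ℕ → Set
HasExactlyBitrades k n m = ∃[ L ]
  ( length L ≡ m
  × (∀ {B} → B ∈ L → IsLatinBitrade B)
  × Data.List.Relation.Unary.Unique.Setoid.Unique (setoid) L
  × (∀ (B : SubsetQ k n) → IsLatinBitrade B → ∃[ C ] (C ∈ L × B ≐ C)) )
  where
    import Data.List.Relation.Unary.Unique.Setoid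
    open import Relation.Binary.Bundles using (Setoid)
    import Relation.Binary.PropositionalEquality as P
    setoid : Setoid 0ℓ 0ℓ
    setoid = record
      { Carrier = SubsetQ k n
      ; _≈_ = _≐_
      ; isEquivalence = record
        { refl = λ w → P.refl
        ; sym = λ e w → P.sym (e w)
        ; trans = λ e f w → P.trans (e w) (f w) } }

-- On a line of Q₃ a set meets 0 or 2 of the 3 points iff the three membership bits xor to false.
-- Hence a latin bitrade B in Q₃^(n+1) is determined by its layers B₀ = B ∩ {x₁ = 0} and
-- B₁ = B ∩ {x₁ = 1}, which are latin bitrades of Q₃^n, its third layer being B₀ ⊕ B₁; conversely
-- every pair of bitrades of Q₃^n stacks this way to a bitrade. So the number of bitrades squares
-- with each dimension, starting from 2 subsets of the one-point cube Q₃^0.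
module Submission where

open import Defs
open import Data.Nat using (ℕ; zero; suc; _+_; _*_; _^_)
open import Data.Nat.Properties using (^-distribˡ-+-*; +-identityʳ)
open import Data.Fin using (Fin; zero; suc)
open import Data.Vec using ([]; _∷_; _[_]≔_)
open import Data.Bool using (Bool; true; false; _xor_; _≟_)
open import Data.Bool.Properties using (xor-same; xor-∧-commutativeRing)
open import Data.List using (List; []; _∷_; _++_; length; map; filter; allFin; cartesianProductWith)
open import Data.List.Properties using (length-map; length-++)
open import Data.List.Membership.Propositional using (_∈_)
open import Data.List.Membership.Propositional.Properties
  using (∈-cartesianProductWith⁺; ∈-cartesianProductWith⁻)
open import Data.List.Relation.Unary.Any using (here; there)
open import Data.List.Relation.Unary.All using ([]; _∷_)
open import Data.List.Relation.Unary.AllPairs using ([]; _∷_)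
open import Data.List.Relation.Unary.Unique.Setoid using (Unique)
open import Data.List.Relation.Unary.Unique.Setoid.Properties using (cartesianProductWith⁺)
open import Data.Product using (_×_; _,_; ∃-syntax)
open import Data.Sum using (_⊎_; inj₁; inj₂)
open import Function using (case_of_)
open import Function.Bundles using (_⇔_; mk⇔; Equivalence)
open import Algebra.Bundles using (CommutativeRing)
open import Algebra.Properties.CommutativeSemigroup
  (CommutativeRing.+-commutativeSemigroup xor-∧-commutativeRing) using (interchange)
open import Relation.Binary.Bundles using (Setoid)
open import Relation.Binary.PropositionalEquality
open import Level using (0ℓ)

trueCount : List Bool → ℕ
trueCount bs = length (filter (_≟ true) bs)

length-filter-≟true : ∀ {A : Set} (f : A → Bool) (xs : List A) →
  length (filter (λ x → f x ≟ true) xs) ≡ trueCount (map f xs)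
length-filter-≟true f []       = refl
length-filter-≟true f (x ∷ xs) with f x
... | true  = cong suc (length-filter-≟true f xs)
... | false = length-filter-≟true f xs

ZeroOrTwo : ℕ → Set
ZeroOrTwo m = m ≡ 0 ⊎ m ≡ 2

zeroOrTwo⇔xor≡false : ∀ a b c → ZeroOrTwo (trueCount (a ∷ b ∷ c ∷ [])) ⇔ ((a xor b) xor c ≡ false)
zeroOrTwo⇔xor≡false a b c = mk⇔ (to a b c) (from a b c)
  where
  to : ∀ a b c → ZeroOrTwo (trueCount (a ∷ b ∷ c ∷ [])) → (a xor b) xor c ≡ false
  to false false false _        = refl
  to false true  true  _        = refl
  to true  false true  _        = refl
  to true  true  false _        = refl
  to false false true  (inj₁ ())
  to false false true  (inj₂ ())
  to false true  false (inj₁ ())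
  to false true  false (inj₂ ())
  to true  false false (inj₁ ())
  to true  false false (inj₂ ())
  to true  true  true  (inj₁ ())
  to true  true  true  (inj₂ ())

  from : ∀ a b c → (a xor b) xor c ≡ false → ZeroOrTwo (trueCount (a ∷ b ∷ c ∷ []))
  from false false false _ = inj₁ refl
  from false true  true  _ = inj₂ refl
  from true  false true  _ = inj₂ refl
  from true  true  false _ = inj₂ refl
  from false false true  ()
  from false true  false ()
  from true  false false ()
  from true  true  true  ()

xor≡false⇒≡ : ∀ a b → a xor b ≡ false → b ≡ a
xor≡false⇒≡ false false _ = refl
xor≡false⇒≡ true  true  _ = refl
xor≡false⇒≡ false true  ()
xor≡false⇒≡ true  false ()

line : ∀ {n} → SubsetQ 3 n → Fin n → Word 3 n → Fin 3 → Bool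
line B i a x = B (a [ i ]≔ x)

parity : (Fin 3 → Bool) → Bool
parity ℓ = (ℓ zero xor ℓ (suc zero)) xor ℓ (suc (suc zero))

IsEven : ∀ {n} → SubsetQ 3 n → Set
IsEven {n} B = ∀ (i : Fin n) (a : Word 3 n) → parity (line B i a) ≡ false

isLatinBitrade⇔isEven : ∀ {n} (B : SubsetQ 3 n) → IsLatinBitrade B ⇔ IsEven B
isLatinBitrade⇔isEven B = mk⇔
  (λ h i a → Equivalence.to (onLine i a) (h i a))
  (λ h i a → Equivalence.from (onLine i a) (h i a))
  where
  onLine : ∀ i a → ZeroOrTwo (faceCount B i a) ⇔ (parity (line B i a) ≡ false)
  onLine i a rewrite length-filter-≟true (line B i a) (allFin 3) =
    zeroOrTwo⇔xor≡false (line B i a zero) (line B i a (suc zero)) (line B i a (suc (suc zero)))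

_⊕_ : ∀ {n} → SubsetQ 3 n → SubsetQ 3 n → SubsetQ 3 n
(B ⊕ C) w = B w xor C w

parity-⊕ : (ℓ ℓ′ : Fin 3 → Bool) → parity (λ x → ℓ x xor ℓ′ x) ≡ parity ℓ xor parity ℓ′
parity-⊕ ℓ ℓ′ = begin
  ((ℓ 0F xor ℓ′ 0F) xor (ℓ 1F xor ℓ′ 1F)) xor (ℓ 2F xor ℓ′ 2F)
    ≡⟨ cong (_xor (ℓ 2F xor ℓ′ 2F)) (interchange (ℓ 0F) (ℓ′ 0F) (ℓ 1F) (ℓ′ 1F)) ⟩
  ((ℓ 0F xor ℓ 1F) xor (ℓ′ 0F xor ℓ′ 1F)) xor (ℓ 2F xor ℓ′ 2F)
    ≡⟨ interchange (ℓ 0F xor ℓ 1F) (ℓ′ 0F xor ℓ′ 1F) (ℓ 2F) (ℓ′ 2F) ⟩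
  parity ℓ xor parity ℓ′ ∎
  where
  open ≡-Reasoning
  0F 1F 2F : Fin 3
  0F = zero
  1F = suc zero
  2F = suc (suc zero)

⊕-isEven : ∀ {n} {B C : SubsetQ 3 n} → IsEven B → IsEven C → IsEven (B ⊕ C)
⊕-isEven {B = B} {C} hB hC i a = begin
  parity (λ x → line B i a x xor line C i a x) ≡⟨ parity-⊕ (line B i a) (line C i a) ⟩
  parity (line B i a) xor parity (line C i a)  ≡⟨ cong₂ _xor_ (hB i a) (hC i a) ⟩
  false                                        ∎
  where open ≡-Reasoning

layer : ∀ {n} → Fin 3 → SubsetQ 3 (suc n) → SubsetQ 3 n
layer x B w = B (x ∷ w)

layer-isEven : ∀ {n} x {B : SubsetQ 3 (suc n)} → IsEven B → IsEven (layer x B)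
layer-isEven x h j w = h (suc j) (x ∷ w)

stack : ∀ {n} → SubsetQ 3 n → SubsetQ 3 n → SubsetQ 3 (suc n)
stack B₀ B₁ (zero ∷ w)           = B₀ w
stack B₀ B₁ (suc zero ∷ w)       = B₁ w
stack B₀ B₁ (suc (suc zero) ∷ w) = (B₀ ⊕ B₁) w

stack-isEven : ∀ {n} {B₀ B₁ : SubsetQ 3 n} → IsEven B₀ → IsEven B₁ → IsEven (stack B₀ B₁)
stack-isEven {B₀ = B₀} {B₁} h₀ h₁ zero (_ ∷ w) = xor-same (B₀ w xor B₁ w)
stack-isEven h₀ h₁ (suc j) (zero ∷ w)           = h₀ j w
stack-isEven h₀ h₁ (suc j) (suc zero ∷ w)       = h₁ j w
stack-isEven {B₀ = B₀} {B₁} h₀ h₁ (suc j) (suc (suc zero) ∷ w) =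
  ⊕-isEven {B = B₀} {B₁} h₀ h₁ j w

stack-cong : ∀ {n} {B₀ B₁ C₀ C₁ : SubsetQ 3 n} → B₀ ≐ C₀ → B₁ ≐ C₁ → stack B₀ B₁ ≐ stack C₀ C₁
stack-cong e₀ e₁ (zero ∷ w)           = e₀ w
stack-cong e₀ e₁ (suc zero ∷ w)       = e₁ w
stack-cong e₀ e₁ (suc (suc zero) ∷ w) = cong₂ _xor_ (e₀ w) (e₁ w)

stack-injective : ∀ {n} {B₀ B₁ C₀ C₁ : SubsetQ 3 n} → stack B₀ B₁ ≐ stack C₀ C₁ → B₀ ≐ C₀ × B₁ ≐ C₁
stack-injective e = (λ w → e (zero ∷ w)) , (λ w → e (suc zero ∷ w))

isEven⇒≐stack : ∀ {n} {B : SubsetQ 3 (suc n)} → IsEven B → B ≐ stack (layer zero B) (layer (suc zero) B)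
isEven⇒≐stack h (zero ∷ w)           = refl
isEven⇒≐stack h (suc zero ∷ w)       = refl
isEven⇒≐stack {B = B} h (suc (suc zero) ∷ w) =
  xor≡false⇒≡ (B (zero ∷ w) xor B (suc zero ∷ w)) (B (suc (suc zero) ∷ w)) (h zero (zero ∷ w))

≐-setoid : ℕ → Setoid 0ℓ 0ℓ
≐-setoid n = record
  { Carrier       = SubsetQ 3 n
  ; _≈_           = _≐_
  ; isEquivalence = record
    { refl  = λ w → refl
    ; sym   = λ e w → sym (e w)
    ; trans = λ e f w → trans (e w) (f w) } }

evenSets : ∀ n → List (SubsetQ 3 n)
evenSets zero    = (λ _ → false) ∷ (λ _ → true) ∷ []
evenSets (suc n) = cartesianProductWith stack (evenSets n) (evenSets n)

length-cartesianProductWith : ∀ {A B C : Set} (f : A → B → C) (xs : List A) (ys : List B) →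
  length (cartesianProductWith f xs ys) ≡ length xs * length ys
length-cartesianProductWith f []       ys = refl
length-cartesianProductWith f (x ∷ xs) ys = begin
  length (map (f x) ys ++ cartesianProductWith f xs ys)
    ≡⟨ length-++ (map (f x) ys) ⟩
  length (map (f x) ys) + length (cartesianProductWith f xs ys)
    ≡⟨ cong₂ _+_ (length-map (f x) ys) (length-cartesianProductWith f xs ys) ⟩
  length ys + length xs * length ys ∎
  where open ≡-Reasoning

length-evenSets : ∀ n → length (evenSets n) ≡ 2 ^ (2 ^ n)
length-evenSets zero    = refl
length-evenSets (suc n) = begin
  length (cartesianProductWith stack (evenSets n) (evenSets n))
    ≡⟨ length-cartesianProductWith stack (evenSets n) (evenSets n) ⟩
  length (evenSets n) * length (evenSets n)
    ≡⟨ cong₂ _*_ (length-evenSets n) (length-evenSets n) ⟩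
  2 ^ (2 ^ n) * 2 ^ (2 ^ n)
    ≡⟨ ^-distribˡ-+-* 2 (2 ^ n) (2 ^ n) ⟨
  2 ^ (2 ^ n + 2 ^ n)
    ≡⟨ cong (λ m → 2 ^ (2 ^ n + m)) (+-identityʳ (2 ^ n)) ⟨
  2 ^ (2 ^ suc n) ∎
  where open ≡-Reasoning

∈-evenSets⇒isEven : ∀ n {B} → B ∈ evenSets n → IsEven B
∈-evenSets⇒isEven zero (here refl)         ()
∈-evenSets⇒isEven zero (there (here refl)) ()
∈-evenSets⇒isEven (suc n) B∈ with ∈-cartesianProductWith⁻ stack (evenSets n) (evenSets n) B∈
... | B₀ , B₁ , B₀∈ , B₁∈ , refl = stack-isEven (∈-evenSets⇒isEven n B₀∈) (∈-evenSets⇒isEven n B₁∈)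

evenSets-unique : ∀ n → Unique (≐-setoid n) (evenSets n)
evenSets-unique zero    = ((λ e → case e [] of λ ()) ∷ []) ∷ [] ∷ []
evenSets-unique (suc n) = cartesianProductWith⁺ (≐-setoid n) (≐-setoid n) (≐-setoid (suc n))
  stack stack-injective (evenSets-unique n) (evenSets-unique n)

isEven⇒∈-evenSets : ∀ n (B : SubsetQ 3 n) → IsEven B → ∃[ C ] (C ∈ evenSets n × B ≐ C)
isEven⇒∈-evenSets zero B _ with B [] in eq
... | false = (λ _ → false) , here refl         , λ { [] → eq }
... | true  = (λ _ → true)  , there (here refl) , λ { [] → eq }
isEven⇒∈-evenSets (suc n) B h
  with isEven⇒∈-evenSets n (layer zero B) (layer-isEven zero {B} h)
     | isEven⇒∈-evenSets n (layer (suc zero) B) (layer-isEven (suc zero) {B} h)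
... | C₀ , C₀∈ , e₀ | C₁ , C₁∈ , e₁ =
  stack C₀ C₁ , ∈-cartesianProductWith⁺ stack C₀∈ C₁∈ ,
  λ w → trans (isEven⇒≐stack {B = B} h w) (stack-cong e₀ e₁ w)

proposition3 : ∀ (n : ℕ) → HasExactlyBitrades 3 (suc n) (2 ^ (2 ^ (suc n)))
proposition3 n =
  evenSets (suc n) ,
  length-evenSets (suc n) ,
  (λ {B} B∈ → Equivalence.from (isLatinBitrade⇔isEven B) (∈-evenSets⇒isEven (suc n) B∈)) ,
  evenSets-unique (suc n) ,
  λ B hB → isEven⇒∈-evenSets (suc n) B (Equivalence.to (isLatinBitrade⇔isEven B) hB)
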